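{- Let $T^*$ be an optimal solution of a UFP instance satisfying the standing assumptions below. Given a set $L'_L$ that is $k$-thin for $L_L$ and a set $L'_R$ that is $k$-thin for $L_R$, there is a set $L'\subseteq L$ that is $2k$-thin for $L$ with $w(L')\le w(L'_L)+w(L'_R)$.
   Context: A UFP instance: a path with vertices $1,\dots,n$ from left to right, edges $e=(v,v+1)$ with capacities $u_e\in\mathbb{Z}_{>0}$, and a finite set $T$ of tasks, each task $i$ having a subpath $P(i)$ from $s(i)$ to $t(i)$, demand $d(i)>0$, profit $w(i)\ge0$. Feasible sets respect all capacities; $T^*$ is a feasible set of maximum profit. $b(i)=\min_{e\in P(i)}u_e$ and $e(i)$ is the edge of $P(i)$ with capacity $b(i)$. Standing assumptions: edge capacities pairwise distinct, $d(i)\le b(i)$, every vertex is start or end vertex of exactly one task. Segments (each with weight $w(i)$ of its task; the weight of a set of segments is the sum): $\ell(i)=(s(i),t(i))\times\{b(i)\}$; if $e(i)=(v,v+1)$, $\ell_L(i)=(s(i),v+1)\times\{b(i)\}$ and $\ell_R(i)=(v,t(i))\times\{b(i)\}$. $L=\{\ell(i):i\in T^*\}$, $L_L=\{\ell_L(i):i\in T^*\}$, $L_R=\{\ell_R(i):i\in T^*\}$ (families indexed by tasks). A vertical segment $\{x\}\times(y_b,y_t)$ intersects a horizontal segment $(a,b)\times\{y\}$ if $a<x<b$ and $y_b<y<y_t$. For a family $L_0$ of segments, a subfamily $L'_0\subseteq L_0$ is $k$-thin for $L_0$ if every vertical segment intersecting more than $k$ segments of $L_0$ intersects at least one segment of 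$L'_0$.
   Formalization: The demands $d(i)$ and profits $w(i)$ take rational values, and the vertical segments in the definition of thinness have rational coordinates. -}

module Defs where

open import Data.Nat as ℕ using (ℕ; zero; suc; _∸_; _≤ᵇ_)
open import Data.Bool using (Bool; true; false; if_then_else_)
open import Data.Fin using (Fin; zero; suc)
open import Data.Vec using (Vec; []; _∷_; lookup; tabulate)
open import Data.Integer using (+_)
open import Data.Rational as ℚ using (ℚ; 0ℚ; _/_; _+_; _<_; _≤_)
open import Data.Rational.Properties using (_<?_)
open import Data.Fin.Subset using (Subset; _∈_; _⊆_; ∣_∣; _∩_)
open import Data.Product using (Σ; _×_; _,_; ∃)
open import Data.Sum using (_⊎_)
open import Relation.Nullary using (¬_; does)
open import Relation.Nullary.Decidable using (_×-dec_)
open import Relation.Binary.PropositionalEquality using (_≡_)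

toℚ : ℕ → ℚ
toℚ n = (+ n) / 1

sumFin : {m : ℕ} → (Fin m → ℚ) → ℚ
sumFin {zero}  f = 0ℚ
sumFin {suc m} f = f zero + sumFin (λ i → f (suc i))

-- UFP instance on the path with vertices 1..n.
-- Edge (v, v+1) is identified with its left vertex v (1 ≤ v < n);
-- its capacity is u v.  Tasks are Fin m.

record UFP : Set where
  field
    n : ℕ
    u : ℕ → ℕ
    m : ℕ
    s t : Fin m → ℕ
    d w : Fin m → ℚ
    s≥1   : ∀ i → 1 ℕ.≤ s i
    s<t   : ∀ i → s i ℕ.< t i
    t≤n   : ∀ i → t i ℕ.≤ n
    u>0   : ∀ v → 1 ℕ.≤ v → v ℕ.< n → 0 ℕ.< u v
    d>0   : ∀ i → 0ℚ < d i
    w≥0   : ∀ i → 0ℚ ≤ w i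

module _ (I : UFP) where
  open UFP I

  argminFrom : ℕ → ℕ → ℕ
  argminFrom a zero    = a
  argminFrom a (suc k) with argminFrom (suc a) k
  ... | j = if u a ≤ᵇ u j then a else j

  -- e(i): bottleneck edge of P(i) (edges s(i), ..., t(i)-1), b(i) = u_{e(i)}
  e : Fin m → ℕ
  e i = argminFrom (s i) (t i ∸ suc (s i))

  b : Fin m → ℕ
  b i = u (e i)

  EndpointAt : Fin m × Bool → ℕ → Set
  EndpointAt (i , true)  v = s i ≡ v
  EndpointAt (i , false) v = t i ≡ v

  record StandingAssumptions : Set where
    field
      distinctCap : ∀ v v′ → 1 ℕ.≤ v → v ℕ.< n → 1 ℕ.≤ v′ → v′ ℕ.< n →
                    ¬ (v ≡ v′) → ¬ (u v ≡ u v′)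
      d≤b         : ∀ i → d i ≤ toℚ (b i)
      uniqueEndpoint : ∀ v → 1 ℕ.≤ v → v ℕ.≤ n →
                    Σ (Fin m × Bool) λ p → EndpointAt p v ×
                      (∀ q → EndpointAt q v → q ≡ p)

  weight : Subset m → ℚ
  weight S = sumFin (λ i → if lookup S i then w i else 0ℚ)

  load : Subset m → ℕ → ℚ
  load S v = sumFin (λ i → if lookup S i then
                             (if (s i ≤ᵇ v) Data.Bool.∧ (suc v ≤ᵇ t i) then d i else 0ℚ)
                           else 0ℚ)

  Feasible : Subset m → Set
  Feasible S = ∀ v → 1 ℕ.≤ v → v ℕ.< n → load S v ≤ toℚ (u v)

  Optimal : Subset m → Set
  Optimal S = Feasible S × (∀ S′ → Feasible S′ → weight S′ ≤ weight S)

-- horizontal open segment (left , right) × {height}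
record HSeg : Set where
  constructor hseg
  field
    left right height : ℕ

-- vertical open segment {x} × (yb , yt)
record VSeg : Set where
  constructor vseg
  field
    x yb yt : ℚ

Intersects : VSeg → HSeg → Set
Intersects (vseg x yb yt) (hseg a c y) =
  (toℚ a < x × x < toℚ c) × (yb < toℚ y × toℚ y < yt)

intersects? : ∀ V h → Relation.Nullary.Dec (Intersects V h)
intersects? (vseg x yb yt) (hseg a c y) =
  ((toℚ a <? x) ×-dec (x <? toℚ c)) ×-dec ((yb <? toℚ y) ×-dec (toℚ y <? yt))

hitSet : {m : ℕ} → (Fin m → HSeg) → VSeg → Subset m
hitSet seg V = tabulate (λ i → does (intersects? V (seg i)))

-- A family of segments indexed by the tasks in I (segment of i is seg i).
Thin : {m : ℕ} → ℕ → (Fin m → HSeg) → Subset m → Subset m → Set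
Thin k seg I J = J ⊆ I ×
  (∀ V → k ℕ.< ∣ I ∩ hitSet seg V ∣ → ∃ λ i → i ∈ J × Intersects V (seg i))

module _ (I : UFP) where
  open UFP I
  ℓ ℓL ℓR : Fin m → HSeg
  ℓ  i = hseg (s i) (t i) (b I i)
  ℓL i = hseg (s i) (suc (e I i)) (b I i)
  ℓR i = hseg (e I i) (t i) (b I i)

-- The bottleneck edge e(i) = (v, v+1) lies on P(i), so the open
-- interval (s(i), t(i)) is the union of the overlapping intervals
-- (s(i), v+1) and (v, t(i)), and both are contained in (s(i), t(i)).  As all
-- three segments have height b(i), a vertical segment meets ℓ(i) iff it meets
-- ℓ_L(i) or ℓ_R(i).  Hence a vertical segment meeting more than 2k segments
-- of L meets more than k segments of L_L or more than k of L_R (pigeonhole),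
-- so it meets a segment of L′_L or of L′_R, and thus the corresponding
-- segment of L.  The weight bound holds because profits are nonnegative.
module Submission where

open import Defs
open import Data.Nat using (ℕ; _*_)
open import Data.Rational using (_≤_; _+_)
open import Data.Fin.Subset using (Subset)
open import Data.Product using (Σ; _×_)

open import Data.Nat as ℕ using (zero; suc; _∸_; _≤ᵇ_)
import Data.Nat.Properties as ℕP
import Data.Integer as ℤ
import Data.Integer.Properties as ℤP
open import Data.Rational using (ℚ; 0ℚ; mkℚ; _<_; *<*; *≤*)
import Data.Rational.Properties as ℚP
open import Data.Rational.Properties using (_<?_)
open import Data.Nat.Coprimality using (1-coprimeTo; sym)
open import Data.Bool using (Bool; true; false; if_then_else_; _∨_)
open import Data.Fin using (Fin)
open import Data.Vec using ([]; _∷_; lookup)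
open import Data.Vec.Properties using (lookup∘tabulate; []=⇒lookup; lookup⇒[]=)
open import Data.Fin.Subset using (_∈_; _⊆_; ∣_∣; _∩_; _∪_)
open import Data.Fin.Subset.Properties
  using (p⊆q⇒∣p∣≤∣q∣; ∣p∣≤∣x∷p∣; x∈p∩q⁻; x∈p∩q⁺; x∈p∪q⁻; x∈p∪q⁺)
open import Data.Product using (_,_; proj₁; proj₂; ∃)
open import Data.Sum as Sum using (_⊎_; inj₁; inj₂; [_,_])
open import Algebra.Bundles using (CommutativeMonoid)
import Algebra.Properties.CommutativeSemigroup as CommSemigroupProps
open import Relation.Nullary using (Dec; yes; no; does)
open import Relation.Nullary.Decidable using (dec-true)
open import Data.Empty using (⊥-elim)
open import Relation.Binary.PropositionalEquality
  using (_≡_; cong; subst; subst₂; trans) renaming (sym to ≡-sym)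

toℚ-normal : ∀ n → toℚ n ≡ mkℚ (ℤ.+ n) 0 (sym (1-coprimeTo n))
toℚ-normal n = ℚP.normalize-coprime (sym (1-coprimeTo n))

toℚ-< : ∀ {a c} → a ℕ.< c → toℚ a < toℚ c
toℚ-< {a} {c} a<c rewrite toℚ-normal a | toℚ-normal c =
  *<* (subst₂ ℤ._<_ (≡-sym (ℤP.*-identityʳ (ℤ.+ a))) (≡-sym (ℤP.*-identityʳ (ℤ.+ c)))
                    (ℤ.+<+ a<c))

toℚ-≤ : ∀ {a c} → a ℕ.≤ c → toℚ a ≤ toℚ c
toℚ-≤ {a} {c} a≤c rewrite toℚ-normal a | toℚ-normal c =
  *≤* (subst₂ ℤ._≤_ (≡-sym (ℤP.*-identityʳ (ℤ.+ a))) (≡-sym (ℤP.*-identityʳ (ℤ.+ c)))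
                    (ℤ.+≤+ a≤c))

does⇒witness : ∀ {P : Set} (P? : Dec P) → does P? ≡ true → P
does⇒witness (yes p) _  = p
does⇒witness (no _)  ()

∈hitSet⁻ : ∀ {m} (seg : Fin m → HSeg) V i → i ∈ hitSet seg V → Intersects V (seg i)
∈hitSet⁻ seg V i i∈hit = does⇒witness (intersects? V (seg i))
  (trans (≡-sym (lookup∘tabulate (λ j → does (intersects? V (seg j))) i)) ([]=⇒lookup i∈hit))

∈hitSet⁺ : ∀ {m} (seg : Fin m → HSeg) V i → Intersects V (seg i) → i ∈ hitSet seg V
∈hitSet⁺ seg V i hit = lookup⇒[]= i _
  (trans (lookup∘tabulate (λ j → does (intersects? V (seg j))) i)
         (dec-true (intersects? V (seg i)) hit))

∣p∪q∣≤∣p∣+∣q∣ : ∀ {n} (p q : Subset n) → ∣ p ∪ q ∣ ℕ.≤ ∣ p ∣ ℕ.+ ∣ q ∣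
∣p∪q∣≤∣p∣+∣q∣ []          []          = ℕ.z≤n
∣p∪q∣≤∣p∣+∣q∣ (true  ∷ p) (y     ∷ q) =
  ℕ.s≤s (ℕP.≤-trans (∣p∪q∣≤∣p∣+∣q∣ p q) (ℕP.+-monoʳ-≤ ∣ p ∣ (∣p∣≤∣x∷p∣ y q)))
∣p∪q∣≤∣p∣+∣q∣ (false ∷ p) (true  ∷ q) =
  subst (ℕ._≤_ (suc ∣ p ∪ q ∣)) (≡-sym (ℕP.+-suc ∣ p ∣ ∣ q ∣)) (ℕ.s≤s (∣p∪q∣≤∣p∣+∣q∣ p q))
∣p∪q∣≤∣p∣+∣q∣ (false ∷ p) (false ∷ q) = ∣p∪q∣≤∣p∣+∣q∣ p q

pigeonhole : ∀ k b c → 2 * k ℕ.< b ℕ.+ c → k ℕ.< b ⊎ k ℕ.< c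
pigeonhole k b c big with k ℕ.<? b | k ℕ.<? c
... | yes k<b | _       = inj₁ k<b
... | no _    | yes k<c = inj₂ k<c
... | no k≮b  | no k≮c  = ⊥-elim (ℕP.<⇒≱ big b+c≤2k)
  where
  b+c≤2k : b ℕ.+ c ℕ.≤ 2 * k
  b+c≤2k = subst (ℕ._≤_ (b ℕ.+ c)) (cong (k ℕ.+_) (≡-sym (ℕP.+-identityʳ k)))
             (ℕP.+-mono-≤ (ℕP.≮⇒≥ k≮b) (ℕP.≮⇒≥ k≮c))

-- The sum of the values w i over the elements i of a subset S; for a UFP
-- instance, weight I S is this sum for the profits w.
selectedSum : ∀ {m} → (Fin m → ℚ) → Subset m → ℚ
selectedSum w S = sumFin (λ i → if lookup S i then w i else 0ℚ)

open CommSemigroupProps (CommutativeMonoid.commutativeSemigroup ℚP.+-0-commutativeMonoid)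
  using (interchange)

select-∨ : ∀ x → 0ℚ ≤ x → (a b : Bool) →
  (if a ∨ b then x else 0ℚ) ≤ (if a then x else 0ℚ) + (if b then x else 0ℚ)
select-∨ x 0≤x true  true  = ℚP.≤-trans (ℚP.≤-reflexive (≡-sym (ℚP.+-identityʳ x)))
                                        (ℚP.+-monoʳ-≤ x 0≤x)
select-∨ x 0≤x true  false = ℚP.≤-reflexive (≡-sym (ℚP.+-identityʳ x))
select-∨ x 0≤x false true  = ℚP.≤-reflexive (≡-sym (ℚP.+-identityˡ x))
select-∨ x 0≤x false false = ℚP.≤-reflexive (≡-sym (ℚP.+-identityʳ 0ℚ))

selectedSum-∪ : ∀ {m} (w : Fin m → ℚ) → (∀ i → 0ℚ ≤ w i) → (A B : Subset m) →
  selectedSum w (A ∪ B) ≤ selectedSum w A + selectedSum w B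
selectedSum-∪ w w≥0 []      []      = ℚP.≤-reflexive (≡-sym (ℚP.+-identityʳ 0ℚ))
selectedSum-∪ w w≥0 (a ∷ A) (b ∷ B) = ℚP.≤-trans
  (ℚP.+-mono-≤ (select-∨ (w zero) (w≥0 zero) a b)
               (selectedSum-∪ (λ i → w (suc i)) (λ i → w≥0 (suc i)) A B))
  (ℚP.≤-reflexive (interchange (if a then w zero else 0ℚ) (if b then w zero else 0ℚ)
                               (selectedSum (λ i → w (suc i)) A)
                               (selectedSum (λ i → w (suc i)) B)))
  where open Data.Fin using (zero; suc)

-- Splitting (a, c) × {y} at an integer e: the intervals (a, e+1) and (e, c)
-- overlap, so a vertical segment meeting the whole meets one of the pieces.
split-meets : ∀ V a c e y → Intersects V (hseg a c y) →
  Intersects V (hseg a (suc e) y) ⊎ Intersects V (hseg e c y)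
split-meets (vseg x yb yt) a c e y ((a<x , x<c) , at-y) with toℚ e <? x
... | yes e<x = inj₂ ((e<x , x<c) , at-y)
... | no  e≮x = inj₁ ((a<x , ℚP.≤-<-trans (ℚP.≮⇒≥ e≮x) (toℚ-< (ℕP.n<1+n e))) , at-y)

widen-meets : ∀ V {a a′ c c′} y → a ℕ.≤ a′ → c′ ℕ.≤ c →
  Intersects V (hseg a′ c′ y) → Intersects V (hseg a c y)
widen-meets (vseg x yb yt) y a≤a′ c′≤c ((a′<x , x<c′) , at-y) =
  (ℚP.≤-<-trans (toℚ-≤ a≤a′) a′<x , ℚP.<-≤-trans x<c′ (toℚ-≤ c′≤c)) , at-y

module _ (I : UFP) where
  open UFP I

  argminFrom-bounds : ∀ a k → a ℕ.≤ argminFrom I a k × argminFrom I a k ℕ.≤ a ℕ.+ k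
  argminFrom-bounds a zero = ℕP.≤-refl , ℕP.≤-reflexive (≡-sym (ℕP.+-identityʳ a))
  argminFrom-bounds a (suc k) with argminFrom I (suc a) k | argminFrom-bounds (suc a) k
  ... | j | (a<j , j≤a+1+k) with u a ≤ᵇ u j
  ... | true  = ℕP.≤-refl , ℕP.m≤m+n a (suc k)
  ... | false = ℕP.≤-trans (ℕP.n≤1+n a) a<j ,
                subst (j ℕ.≤_) (≡-sym (ℕP.+-suc a k)) j≤a+1+k

  e-on-path : ∀ i → s i ℕ.≤ e I i × suc (e I i) ℕ.≤ t i
  e-on-path i with argminFrom-bounds (s i) (t i ∸ suc (s i))
  ... | s≤e , e≤end = s≤e , subst (suc (e I i) ℕ.≤_) (ℕP.m+[n∸m]≡n (s<t i)) (ℕ.s≤s e≤end)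

  ℓ-split : ∀ V i → Intersects V (ℓ I i) → Intersects V (ℓL I i) ⊎ Intersects V (ℓR I i)
  ℓ-split V i = split-meets V (s i) (t i) (e I i) (b I i)

  ℓL⇒ℓ : ∀ V i → Intersects V (ℓL I i) → Intersects V (ℓ I i)
  ℓL⇒ℓ V i = widen-meets V {s i} {s i} {t i} {suc (e I i)} (b I i) ℕP.≤-refl (proj₂ (e-on-path i))

  ℓR⇒ℓ : ∀ V i → Intersects V (ℓR I i) → Intersects V (ℓ I i)
  ℓR⇒ℓ V i = widen-meets V {s i} {e I i} {t i} {t i} (b I i) (proj₁ (e-on-path i)) ℕP.≤-refl

-- If meeting seg i is equivalent to meeting
-- segL i or segR i, then a k-thin subfamily for segL together with a k-thin
-- subfamily for segR is 2k-thin for seg: a vertical segment meeting more than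
-- 2k segments of seg meets more than k of segL or more than k of segR.
thin-∪ : ∀ {m} k (seg segL segR : Fin m → HSeg) (S JL JR : Subset m) →
  (∀ V i → Intersects V (seg i) → Intersects V (segL i) ⊎ Intersects V (segR i)) →
  (∀ V i → Intersects V (segL i) → Intersects V (seg i)) →
  (∀ V i → Intersects V (segR i) → Intersects V (seg i)) →
  Thin k segL S JL → Thin k segR S JR → Thin (2 * k) seg S (JL ∪ JR)
thin-∪ k seg segL segR S JL JR split L⇒ R⇒ (JL⊆S , thinL) (JR⊆S , thinR) =
  (λ i∈J → [ JL⊆S , JR⊆S ] (x∈p∪q⁻ JL JR i∈J)) , thin
  where
  hitIn : (Fin _ → HSeg) → VSeg → Subset _
  hitIn sg V = S ∩ hitSet sg V

  hit-cover : ∀ V → hitIn seg V ⊆ hitIn segL V ∪ hitIn segR V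
  hit-cover V {i} i∈hit with x∈p∩q⁻ S (hitSet seg V) i∈hit
  ... | i∈S , i∈hitSet = x∈p∪q⁺ (Sum.map
        (λ h → x∈p∩q⁺ (i∈S , ∈hitSet⁺ segL V i h))
        (λ h → x∈p∩q⁺ (i∈S , ∈hitSet⁺ segR V i h))
        (split V i (∈hitSet⁻ seg V i i∈hitSet)))

  hit-count : ∀ V → ∣ hitIn seg V ∣ ℕ.≤ ∣ hitIn segL V ∣ ℕ.+ ∣ hitIn segR V ∣
  hit-count V = ℕP.≤-trans (p⊆q⇒∣p∣≤∣q∣ (hit-cover V)) (∣p∪q∣≤∣p∣+∣q∣ (hitIn segL V) (hitIn segR V))

  thin : ∀ V → 2 * k ℕ.< ∣ hitIn seg V ∣ → ∃ λ i → i ∈ JL ∪ JR × Intersects V (seg i)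
  thin V many with pigeonhole k _ _ (ℕP.<-≤-trans many (hit-count V))
  ... | inj₁ manyL = let (i , i∈JL , h) = thinL V manyL in i , x∈p∪q⁺ (inj₁ i∈JL) , L⇒ V i h
  ... | inj₂ manyR = let (i , i∈JR , h) = thinR V manyR in i , x∈p∪q⁺ (inj₂ i∈JR) , R⇒ V i h

lemma11 : (I : UFP) → StandingAssumptions I →
    (T* : Subset (UFP.m I)) → Optimal I T* →
    (k : ℕ) (L′L L′R : Subset (UFP.m I)) →
    Thin k (ℓL I) T* L′L → Thin k (ℓR I) T* L′R →
    Σ (Subset (UFP.m I)) λ L′ →
    Thin (2 * k) (ℓ I) T* L′ × (weight I L′ ≤ weight I L′L + weight I L′R)
lemma11 I _ T* _ k L′L L′R thinL thinR =
  L′L ∪ L′R ,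
  thin-∪ k (ℓ I) (ℓL I) (ℓR I) T* L′L L′R (ℓ-split I) (ℓL⇒ℓ I) (ℓR⇒ℓ I) thinL thinR ,
  selectedSum-∪ (UFP.w I) (UFP.w≥0 I) L′L L′R
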